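{- Let $\mathfrak{v}$ be a language valuation over a set $X$ and $w$ a word over $X$. For all terms $t$, if $\ell \in \hat{\mathfrak{v}}^{w}(t)$ then $w \in \hat{\mathfrak{v}}(t)$.
   Context: Let $\mathbf{V}$ be a set of variables. Terms are generated by $t, s ::= x \mid \mathrm{I} \mid \bot \mid t \cdot s \mid t \cup s \mid t^{*} \mid x^{ - }$ ($x \in \mathbf{V}$). For a set $X$, a language valuation over $X$ is a map $\mathfrak{v}$ from variables to subsets of $X^{*}$ ($\mathrm{I}$ = empty word), extended to terms $\hat{\mathfrak{v}}$ by $\hat{\mathfrak{v}}(\mathrm{I}) = \{\mathrm{I}\}$, $\hat{\mathfrak{v}}(\bot) = \emptyset$, $\hat{\mathfrak{v}}(t\cdot s) = \{ab \mid a \in \hat{\mathfrak{v}}(t), b \in \hat{\mathfrak{v}}(s)\}$, $\hat{\mathfrak{v}}(t \cup s) = \hat{\mathfrak{v}}(t)\cup\hat{\mathfrak{v}}(s)$, $\hat{\mathfrak{v}}(t^{*}) = \hat{\mathfrak{v}}(t)^{*}$, $\hat{\mathfrak{v}}(x^{ - }) = X^{*} \setminus \mathfrak{v}(x)$. For a language valuation $\mathfrak{v}$ over $X$ and a word $w$ over $X$, $\mathfrak{v}^{w}$ is the language valuation over the one-letter set $\{\ell\}$ given by $\mathfrak{v}^{w}(x) = \{\mathrm{I} \mid \mathrm{I} \in \mathfrak{v}(x)\} \cup \{\ell \mid w \in \mathfrak{v}(x)\}$. -}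

module Defs where

open import Data.List using (List; []; _∷_; _++_)
open import Data.Product using (Σ; _×_; _,_)
open import Data.Sum using (_⊎_)
open import Data.Unit using (⊤; tt)
open import Data.Empty using (⊥)
open import Relation.Nullary using (¬_)
open import Relation.Binary.PropositionalEquality using (_≡_)

data Term (V : Set) : Set where
  var  : V → Term V
  I    : Term V
  bot  : Term V
  _·_  : Term V → Term V → Term V
  _∪_  : Term V → Term V → Term V
  _*   : Term V → Term V
  _⁻   : V → Term V

Lang : Set → Set₁
Lang X = List X → Set

Concat : {X : Set} → Lang X → Lang X → Lang X
Concat L M w = Σ _ λ a → Σ _ λ b → (w ≡ a ++ b) × L a × M b

data Star {X : Set} (L : Lang X) : Lang X where
  ε    : Star L []
  cons : ∀ {a b} → L a → Star L b → Star L (a ++ b)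

LangVal : Set → Set → Set₁
LangVal V X = V → Lang X

⟦_⟧ : {V X : Set} → Term V → LangVal V X → Lang X
⟦ var x ⟧ v w = v x w
⟦ I ⟧ v w = w ≡ []
⟦ bot ⟧ v w = ⊥
⟦ t · s ⟧ v = Concat (⟦ t ⟧ v) (⟦ s ⟧ v)
⟦ t ∪ s ⟧ v w = ⟦ t ⟧ v w ⊎ ⟦ s ⟧ v w
⟦ t * ⟧ v = Star (⟦ t ⟧ v)
⟦ x ⁻ ⟧ v w = ¬ v x w

ℓ : ⊤
ℓ = tt

_^_ : {V X : Set} → LangVal V X → List X → LangVal V ⊤
(v ^ w) x u = (u ≡ [] × v x []) ⊎ (u ≡ ℓ ∷ [] × v x w)

{-# OPTIONS --safe #-}
module Submission where

-- By induction on t, membership of the empty word in v̂^w(t) transfers to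
-- membership of the empty word in v̂(t), and then membership of ℓ to
-- membership of w.  A factorisation of ℓ has one factor ℓ and the other empty,
-- so it becomes the factorisation w = [] ++ w or w ++ [].  For a complement x⁻
-- the transfer is needed in the converse direction, which holds for variables
-- because v^w(x) contains exactly the images of I and w that v(x) contains.

open import Defs
open import Data.List using (List; []; _∷_; _++_; [_])
open import Data.List.Properties using (++-conicalˡ; ++-conicalʳ; ++-identityʳ)
open import Data.Product using (_×_; _,_)
open import Data.Sum using (_⊎_; inj₁; inj₂)
open import Relation.Binary.PropositionalEquality using (_≡_; refl; sym; subst)

++-≡-[_] : {A : Set} (x : A) {a b : List A} → a ++ b ≡ [ x ] →
           (a ≡ [] × b ≡ [ x ]) ⊎ (a ≡ [ x ] × b ≡ [])
++-≡-[ x ] {[]}         refl = inj₁ (refl , refl)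
++-≡-[ x ] {_ ∷ []} {[]} refl = inj₂ (refl , refl)

module _ {V X : Set} (v : LangVal V X) (w : List X) where

  ∈[]-^-transfer : (t : Term V) → ⟦ t ⟧ (v ^ w) [] → ⟦ t ⟧ v []
  ∈[]-^-transfer (var x) (inj₁ (_ , p)) = p
  ∈[]-^-transfer I       _              = refl
  ∈[]-^-transfer (t · s) (a , b , eq , p , q)
    with refl ← ++-conicalˡ a b (sym eq) | refl ← ++-conicalʳ a b (sym eq)
    = [] , [] , refl , ∈[]-^-transfer t p , ∈[]-^-transfer s q
  ∈[]-^-transfer (t ∪ s) (inj₁ p) = inj₁ (∈[]-^-transfer t p)
  ∈[]-^-transfer (t ∪ s) (inj₂ q) = inj₂ (∈[]-^-transfer s q)
  ∈[]-^-transfer (t *)   _        = ε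
  ∈[]-^-transfer (x ⁻)   ¬p p     = ¬p (inj₁ (refl , p))

  mutual
    ∈ℓ-^-transfer : (t : Term V) → ⟦ t ⟧ (v ^ w) [ ℓ ] → ⟦ t ⟧ v w
    ∈ℓ-^-transfer (var x) (inj₂ (_ , p)) = p
    ∈ℓ-^-transfer (t · s) (a , b , eq , p , q) with ++-≡-[ ℓ ] {a} {b} (sym eq)
    ... | inj₁ (refl , refl) = [] , w , refl , ∈[]-^-transfer t p , ∈ℓ-^-transfer s q
    ... | inj₂ (refl , refl) =
      w , [] , sym (++-identityʳ w) , ∈ℓ-^-transfer t p , ∈[]-^-transfer s q
    ∈ℓ-^-transfer (t ∪ s) (inj₁ p) = inj₁ (∈ℓ-^-transfer t p)
    ∈ℓ-^-transfer (t ∪ s) (inj₂ q) = inj₂ (∈ℓ-^-transfer s q)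
    ∈ℓ-^-transfer (t *)   p        = Star-ℓ-transfer t p refl
    ∈ℓ-^-transfer (x ⁻)   ¬p p     = ¬p (inj₂ (refl , p))

    Star-ℓ-transfer : (t : Term V) {u : List _} →
                      Star (⟦ t ⟧ (v ^ w)) u → u ≡ [ ℓ ] → Star (⟦ t ⟧ v) w
    Star-ℓ-transfer t ε ()
    Star-ℓ-transfer t (cons {a} {b} p ps) eq with ++-≡-[ ℓ ] {a} {b} eq
    ... | inj₁ (refl , refl) = cons {a = []} (∈[]-^-transfer t p) (Star-ℓ-transfer t ps refl)
    ... | inj₂ (refl , refl) =
      subst (Star (⟦ t ⟧ v)) (++-identityʳ w) (cons (∈ℓ-^-transfer t p) ε)

lemma4p3 : {V X : Set} (v : LangVal V X) (w : List X) (t : Term V) →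
           ⟦ t ⟧ (v ^ w) (ℓ ∷ []) → ⟦ t ⟧ v w
lemma4p3 = ∈ℓ-^-transfer
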